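{- Let $\kappa$ be a collineation of $\mathrm{PG}(1,q^t)$ belonging to $\mathrm{P\Gamma L}_2(q^t)$ whose accompanying field automorphism $\eta$ lies in $\mathrm{Gal}(\mathbb{F}_{q^t}/\mathbb{F}_q)$. Then the map $\iota^{ -1}\kappa\iota:\mathrm{PG}(1,F)\to\mathrm{PG}(1,F)$ (apply $\iota^{ -1}$, then $\kappa$, then $\iota$) is the restriction to $\mathrm{PG}(1,F)$ of at least one projectivity of $\mathrm{PG}(1,E)$. Conversely, if $\pi$ is a projectivity of $\mathrm{PG}(1,E)$ with $\mathrm{PG}(1,F)^\pi=\mathrm{PG}(1,F)$, then $\iota\,\pi\,\iota^{ -1}$ (restriction of $\pi$ transported to $\mathrm{PG}(1,q^t)$) is a collineation in $\mathrm{P\Gamma L}_2(q^t)$ whose accompanying automorphism lies in $\mathrm{Gal}(\mathbb{F}_{q^t}/\mathbb{F}_q)$.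
   Context: Let $q$ be a prime power, $t\ge 2$, and $E=\mathrm{End}_{\mathbb{F}_q}(\mathbb{F}_{q^t})$, the ring of $\mathbb{F}_q$-linear maps $\mathbb{F}_{q^t}\to\mathbb{F}_{q^t}$, maps written on the right and composed left to right; $E^*$ is its unit group. For $a\in\mathbb{F}_{q^t}$ let $\rho_a\in E$ be $x\mapsto ax$. $E^2$ is a left $E$-module of row vectors with $\mathrm{GL}_2(E)$ acting from the right. A pair $(\alpha,\beta)\in E^2$ is admissible if it is the first row of a matrix in $\mathrm{GL}_2(E)$. The projective line $\mathrm{PG}(1,E)$ is the set of cyclic submodules $E(\alpha,\beta)$ with $(\alpha,\beta)$ admissible; $E(\alpha,\beta)=E(\alpha',\beta')$ iff $(\alpha',\beta')=(\gamma\alpha,\gamma\beta)$ for some $\gamma\in E^*$. A projectivity of $\mathrm{PG}(1,E)$ is a map $E(\alpha,\beta)\mapsto E((\alpha,\beta)M)$ for a fixed $M\in\mathrm{GL}_2(E)$. $\mathrm{PG}(1,F)$ denotes $\{E(\rho_a,\rho_b): (a,b)\in\mathbb{F}_{q^t}^2\setminus\{(0,0)\}\}$, and $\iota:\mathrm{PG}(1,q^t)\to\mathrm{PG}(1,E)$, $\langle(a,b)\rangle_{q^t}\mapsto E(\rho_a,\rho_b)$, is an injection with image $\mathrm{PG}(1,F)$. Composition of maps is written left to right. A collineation in $\mathrm{P\Gamma L}_2(q^t)$ has the form $\langle(a,b)\rangle_{q^t}\mapsto\langle(a^\eta,b^\eta)M\rangle_{q^t}$ with $M\in\mathrm{GL}_2(q^t)$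 and $\eta$ a field automorphism of $\mathbb{F}_{q^t}$ (its accompanying automorphism). -}

module Defs where

open import Data.Nat using (ℕ; _^_; _≤_)
open import Data.Nat.Primality using (Prime)
open import Data.Bool using (Bool; true)
open import Data.Fin using (Fin)
open import Data.Product using (Σ; _×_; _,_)
open import Function.Bundles using (_↔_)
open import Relation.Binary.PropositionalEquality using (_≡_; _≢_)
open import Relation.Nullary using (¬_)
open import Algebra.Structures using (IsCommutativeRing)

IsPrimePower : ℕ → Set
IsPrimePower q = Σ ℕ λ p → Σ ℕ λ k → Prime p × 1 ≤ k × q ≡ p ^ k

record Field : Set₁ where
  infixl 6 _+_
  infixl 7 _*_
  field
    Carrier : Set
    _+_ _*_ : Carrier → Carrier → Carrier
    -_ : Carrier → Carrier
    0# 1# : Carrier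
    isCommutativeRing : IsCommutativeRing _≡_ _+_ _*_ -_ 0# 1#
    0≢1 : 0# ≢ 1#
    inverse : ∀ x → x ≢ 0# → Σ Carrier λ y → x * y ≡ 1#

-- Everything below is relative to a field K (playing F_{q^t}) and a
-- decidable subset Fq of K (playing the subfield F_q).
module Setup (K : Field) (Fq : Field.Carrier K → Bool) where
  open Field K public

  record IsSubfield : Set where
    field
      has0 : Fq 0# ≡ true
      has1 : Fq 1# ≡ true
      +-closed : ∀ x y → Fq x ≡ true → Fq y ≡ true → Fq (x + y) ≡ true
      neg-closed : ∀ x → Fq x ≡ true → Fq (- x) ≡ true
      *-closed : ∀ x y → Fq x ≡ true → Fq y ≡ true → Fq (x * y) ≡ true
      inv-closed : ∀ x → Fq x ≡ true → x ≢ 0# →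
                   Σ Carrier λ y → Fq y ≡ true × x * y ≡ 1#

  HasSize : ℕ → Set
  HasSize n = Carrier ↔ Fin n

  SubfieldHasSize : ℕ → Set
  SubfieldHasSize n = (Σ Carrier λ x → Fq x ≡ true) ↔ Fin n

  record Mat2 (A : Set) : Set where
    constructor mat
    field
      m11 m12 m21 m22 : A
  open Mat2 public

  _⊗K_ : Mat2 Carrier → Mat2 Carrier → Mat2 Carrier
  M ⊗K N = mat (m11 M * m11 N + m12 M * m21 N) (m11 M * m12 N + m12 M * m22 N)
               (m21 M * m11 N + m22 M * m21 N) (m21 M * m12 N + m22 M * m22 N)

  IK : Mat2 Carrier
  IK = mat 1# 0# 0# 1#

  IsGL2K : Mat2 Carrier → Set
  IsGL2K M = Σ (Mat2 Carrier) λ N → M ⊗K N ≡ IK × N ⊗K M ≡ IK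

  _·K_ : Carrier × Carrier → Mat2 Carrier → Carrier × Carrier
  (a , b) ·K M = (a * m11 M + b * m21 M , a * m12 M + b * m22 M)

  NonZeroPair : Carrier → Carrier → Set
  NonZeroPair a b = ¬ (a ≡ 0# × b ≡ 0#)

  record IsGal (η : Carrier → Carrier) : Set where
    field
      hom+ : ∀ x y → η (x + y) ≡ η x + η y
      hom* : ∀ x y → η (x * y) ≡ η x * η y
      hom1 : η 1# ≡ 1#
      η⁻¹ : Carrier → Carrier
      left-inv : ∀ x → η⁻¹ (η x) ≡ x
      right-inv : ∀ x → η (η⁻¹ x) ≡ x
      fixes-Fq : ∀ c → Fq c ≡ true → η c ≡ c

  -- The ring E = End_{F_q}(K), maps written on the right

  Fn : Set
  Fn = Carrier → Carrier

  record Lin : Set where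
    constructor lin
    field
      fun : Fn
      additive : ∀ x y → fun (x + y) ≡ fun x + fun y
      homog : ∀ c x → Fq c ≡ true → fun (c * x) ≡ c * fun x
  open Lin public

  _≐_ : Fn → Fn → Set
  f ≐ g = ∀ x → f x ≡ g x

  _∙_ : Fn → Fn → Fn
  (f ∙ g) x = g (f x)

  _⊞_ : Fn → Fn → Fn
  (f ⊞ g) x = f x + g x

  idE zeroE : Fn
  idE x = x
  zeroE _ = 0#

  ρ : Carrier → Fn
  ρ a x = a * x

  IsUnitE : Lin → Set
  IsUnitE γ = Σ Lin λ δ → (fun γ ∙ fun δ) ≐ idE × (fun δ ∙ fun γ) ≐ idE

  funM : Mat2 Lin → Mat2 Fn
  funM N = mat (fun (m11 N)) (fun (m12 N)) (fun (m21 N)) (fun (m22 N))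

  _⊗E_ : Mat2 Fn → Mat2 Fn → Mat2 Fn
  M ⊗E N = mat ((m11 M ∙ m11 N) ⊞ (m12 M ∙ m21 N)) ((m11 M ∙ m12 N) ⊞ (m12 M ∙ m22 N))
               ((m21 M ∙ m11 N) ⊞ (m22 M ∙ m21 N)) ((m21 M ∙ m12 N) ⊞ (m22 M ∙ m22 N))

  _≐M_ : Mat2 Fn → Mat2 Fn → Set
  M ≐M N = (m11 M ≐ m11 N) × (m12 M ≐ m12 N) × (m21 M ≐ m21 N) × (m22 M ≐ m22 N)

  IE : Mat2 Fn
  IE = mat idE zeroE zeroE idE

  IsGL2E : Mat2 Lin → Set
  IsGL2E N = Σ (Mat2 Lin) λ N' →
    (funM N ⊗E funM N') ≐M IE × (funM N' ⊗E funM N) ≐M IE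

  _·E_ : Fn × Fn → Mat2 Lin → Fn × Fn
  (α , β) ·E N = ((α ∙ fun (m11 N)) ⊞ (β ∙ fun (m21 N)) ,
                  (α ∙ fun (m12 N)) ⊞ (β ∙ fun (m22 N)))

  -- E(α',β') = E(α,β): (α',β') = (γα, γβ) for some γ ∈ E*
  _∼_ : Fn × Fn → Fn × Fn → Set
  (α' , β') ∼ (α , β) = Σ Lin λ γ → IsUnitE γ × α' ≐ (fun γ ∙ α) × β' ≐ (fun γ ∙ β)

  -- ι : ⟨(a,b)⟩ ↦ E(ρ_a, ρ_b)  (on representatives)
  ι : Carrier × Carrier → Fn × Fn
  ι (a , b) = (ρ a , ρ b)

  -- the image under the projectivity with matrix N of E(α,β) is E((α,β)N)
  -- PG(1,F)^π = PG(1,F)  (both inclusions)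
  PreservesPGF : Mat2 Lin → Set
  PreservesPGF N =
    (∀ a b → NonZeroPair a b →
       Σ Carrier λ c → Σ Carrier λ d → NonZeroPair c d × (ι (a , b) ·E N) ∼ ι (c , d))
    × (∀ c d → NonZeroPair c d →
       Σ Carrier λ a → Σ Carrier λ b → NonZeroPair a b × (ι (a , b) ·E N) ∼ ι (c , d))

-- With maps written on the right, the matrix with entries η ρ_{mᵢⱼ} (apply η, then multiply
-- by mᵢⱼ) lies in GL₂(E) with inverse entries ρ_{m′ᵢⱼ} η⁻¹, and since η(ax) = a^η η(x) it sends
-- (ρ_a, ρ_b) to η · (ρ_{a′}, ρ_{b′}) with (a′, b′) = (a^η, b^η)M.
--
-- Conversely, the images of the points (1,0) and (0,1) show that the rows of N are
-- γ₁ ρ(c₁, d₁) and γ₂ ρ(c₂, d₂) for units γᵢ of E, and N⁻¹N = 1 evaluated at 1 gives a left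
-- inverse of C = (cᵢ dᵢ), so C is invertible. The image of (a, 1) then forces γ₁(ax) to be a
-- multiple of γ₂(x) for every a. Hence γ₂ = μγ₁ and γ₁(ax) = a^η γ₁(x) with
-- a^η = γ₁(a)/γ₁(1), a field automorphism fixing F_q because γ₁ is F_q-linear and bijective;
-- so N is the matrix of the first part for η and M = diag(1, μ) C.

module Submission where

open import Defs
open import Data.Nat using (ℕ; _^_; _≤_)
open import Data.Bool using (Bool)
open import Data.Product using (Σ; _×_; _,_; proj₁; proj₂; map)
open import Algebra.Bundles using (CommutativeRing)
open import Algebra.Structures using (IsCommutativeRing)
open import Relation.Binary.PropositionalEquality

module _ (K : Field) (Fq : Field.Carrier K → Bool) where
  open Setup K Fq
  open IsCommutativeRing isCommutativeRing
    using (+-comm; *-assoc; *-comm; distribˡ; distribʳ; zeroˡ; zeroʳ;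
           +-identityˡ; +-identityʳ; *-identityˡ; *-identityʳ; -‿inverseʳ; _-_)

  commutativeRing : CommutativeRing _ _
  commutativeRing = record { isCommutativeRing = isCommutativeRing }

  open import Algebra.Properties.Ring (CommutativeRing.ring commutativeRing)
    using (-‿distribˡ-*; -‿distribʳ-*; x+x≈x⇒x≈0; x[y-z]≈xy-xz)
  open import Algebra.Properties.AbelianGroup (CommutativeRing.+-abelianGroup commutativeRing)
    using (⁻¹-∙-comm; ⁻¹-involutive)
  open import Algebra.Solver.Ring.NaturalCoefficients.Default
    (CommutativeRing.commutativeSemiring commutativeRing) using (solve; _:=_; _:+_; _:*_)
  open ≡-Reasoning

  *-cancelˡ : ∀ {c x y} → c ≢ 0# → c * x ≡ c * y → x ≡ y
  *-cancelˡ {c} {x} {y} c≢0 cx≡cy = begin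
    x              ≡⟨ sym (*-identityˡ x) ⟩
    1# * x         ≡⟨ cong (_* x) (sym c⁻¹c≡1) ⟩
    (c⁻¹ * c) * x  ≡⟨ *-assoc c⁻¹ c x ⟩
    c⁻¹ * (c * x)  ≡⟨ cong (c⁻¹ *_) cx≡cy ⟩
    c⁻¹ * (c * y)  ≡⟨ sym (*-assoc c⁻¹ c y) ⟩
    (c⁻¹ * c) * y  ≡⟨ cong (_* y) c⁻¹c≡1 ⟩
    1# * y         ≡⟨ *-identityˡ y ⟩
    y              ∎
    where
    c⁻¹ : Carrier
    c⁻¹ = proj₁ (inverse c c≢0)
    c⁻¹c≡1 : c⁻¹ * c ≡ 1#
    c⁻¹c≡1 = trans (*-comm c⁻¹ c) (proj₂ (inverse c c≢0))

  *-nonzero : ∀ {x y} → x ≢ 0# → y ≢ 0# → x * y ≢ 0#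
  *-nonzero {x} {y} x≢0 y≢0 xy≡0 = y≢0 (*-cancelˡ x≢0 (trans xy≡0 (sym (zeroʳ x))))

  nonzero-factorˡ : ∀ {x y} → x * y ≢ 0# → x ≢ 0#
  nonzero-factorˡ {x} {y} xy≢0 x≡0 = xy≢0 (trans (cong (_* y) x≡0) (zeroˡ y))

  -- The semiring solver knows no negation: this moves subtracted terms across.
  -‿move : ∀ {a b c d} → a + d ≡ c + b → a - b ≡ c - d
  -‿move {a} {b} {c} {d} a+d≡c+b = begin
    a + - b                    ≡⟨ sym (+-identityʳ _) ⟩
    a + - b + 0#               ≡⟨ cong (a + - b +_) (sym (-‿inverseʳ d)) ⟩
    a + - b + (d + - d)        ≡⟨ medial a (- b) d (- d) ⟩
    (a + d) + (- b + - d)      ≡⟨ cong₂ _+_ a+d≡c+b (+-comm (- b) (- d)) ⟩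
    (c + b) + (- d + - b)      ≡⟨ sym (medial c (- d) b (- b)) ⟩
    c + - d + (b + - b)        ≡⟨ cong (c + - d +_) (-‿inverseʳ b) ⟩
    c + - d + 0#               ≡⟨ +-identityʳ _ ⟩
    c + - d                    ∎
    where
    medial : ∀ x y z w → x + y + (z + w) ≡ (x + z) + (y + w)
    medial = solve 4 (λ x y z w → x :+ y :+ (z :+ w) := (x :+ z) :+ (y :+ w)) refl

  *-negʳ : ∀ x y → x * - y ≡ - (x * y)
  *-negʳ x y = sym (-‿distribʳ-* x y)

  *-negˡ : ∀ x y → - x * y ≡ - (x * y)
  *-negˡ x y = sym (-‿distribˡ-* x y)

  -‿*-expand : ∀ a b c d → (a - b) * (c - d) ≡ (a * c + b * d) - (a * d + b * c)
  -‿*-expand a b c d = begin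
    (a + - b) * (c + - d)                            ≡⟨ distribute a (- b) c (- d) ⟩
    a * c + - b * - d + (a * - d + - b * c)          ≡⟨ cong₂ (λ u v → a * c + u + v) neg-neg
                                                          (cong₂ _+_ (*-negʳ a d) (*-negˡ b c)) ⟩
    a * c + b * d + (- (a * d) + - (b * c))          ≡⟨ cong (a * c + b * d +_) (⁻¹-∙-comm (a * d) (b * c)) ⟩
    a * c + b * d + - (a * d + b * c)                ∎
    where
    distribute : ∀ a nb c nd → (a + nb) * (c + nd) ≡ a * c + nb * nd + (a * nd + nb * c)
    distribute = solve 4 (λ a nb c nd → (a :+ nb) :* (c :+ nd) := a :* c :+ nb :* nd :+ (a :* nd :+ nb :* c)) refl
    neg-neg : - b * - d ≡ b * d
    neg-neg = trans (*-negˡ b (- d)) (trans (cong -_ (*-negʳ b d)) (⁻¹-involutive (b * d)))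

  -- 2 × 2 matrices over K

  mat-rows : ∀ {a b c d a′ b′ c′ d′ : Carrier} → (a , b) ≡ (a′ , b′) → (c , d) ≡ (c′ , d′) →
             mat a b c d ≡ mat a′ b′ c′ d′
  mat-rows refl refl = refl

  det : Mat2 Carrier → Carrier
  det M = m11 M * m22 M - m12 M * m21 M

  det-⊗K : ∀ A B → det (A ⊗K B) ≡ det A * det B
  det-⊗K (mat a b c d) (mat e f g h) = begin
    det (mat a b c d ⊗K mat e f g h)               ≡⟨ -‿move (cancel a b c d e f g h) ⟩
    (a * d * (e * h) + b * c * (f * g)) - (a * d * (f * g) + b * c * (e * h))
                                                   ≡⟨ sym (-‿*-expand (a * d) (b * c) (e * h) (f * g)) ⟩
    det (mat a b c d) * det (mat e f g h)          ∎
    where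
    cancel : ∀ a b c d e f g h →
      (a * e + b * g) * (c * f + d * h) + (a * d * (f * g) + b * c * (e * h))
        ≡ (a * d * (e * h) + b * c * (f * g)) + (a * f + b * h) * (c * e + d * g)
    cancel = solve 8 (λ a b c d e f g h →
      (a :* e :+ b :* g) :* (c :* f :+ d :* h) :+ (a :* d :* (f :* g) :+ b :* c :* (e :* h))
        := (a :* d :* (e :* h) :+ b :* c :* (f :* g)) :+ (a :* f :+ b :* h) :* (c :* e :+ d :* g)) refl

  det-IK : det IK ≡ 1#
  det-IK = trans (cong₂ _-_ (*-identityˡ 1#) (zeroˡ 0#)) (trans (cong (1# +_) neg0) (+-identityʳ 1#))
    where
    neg0 : - 0# ≡ 0#
    neg0 = trans (sym (+-identityˡ (- 0#))) (-‿inverseʳ 0#)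

  det-scaleRow₂ : ∀ a b c d μ → det (mat a b (μ * c) (μ * d)) ≡ μ * det (mat a b c d)
  det-scaleRow₂ a b c d μ = begin
    a * (μ * d) - b * (μ * c)  ≡⟨ cong₂ _-_ (swap a μ d) (swap b μ c) ⟩
    μ * (a * d) - μ * (b * c)  ≡⟨ sym (x[y-z]≈xy-xz μ (a * d) (b * c)) ⟩
    μ * (a * d - b * c)        ∎
    where
    swap : ∀ x y z → x * (y * z) ≡ y * (x * z)
    swap = solve 3 (λ x y z → x :* (y :* z) := y :* (x :* z)) refl

  adjugate : Mat2 Carrier → Mat2 Carrier
  adjugate M = mat (m22 M) (- m12 M) (- m21 M) (m11 M)

  scalar : Carrier → Mat2 Carrier
  scalar d = mat d 0# 0# d

  _•_ : Carrier → Mat2 Carrier → Mat2 Carrier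
  k • M = mat (k * m11 M) (k * m12 M) (k * m21 M) (k * m22 M)

  *-comm-cancel : ∀ x y → x * y - y * x ≡ 0#
  *-comm-cancel x y = trans (cong (λ u → x * y - u) (*-comm y x)) (-‿inverseʳ (x * y))

  *-neg-cancel : ∀ x y → x * - y + y * x ≡ 0#
  *-neg-cancel x y = trans (+-comm _ _)
    (trans (cong (y * x +_) (trans (*-negʳ x y) (cong -_ (*-comm x y)))) (-‿inverseʳ (y * x)))

  ⊗K-adjugate : ∀ M → M ⊗K adjugate M ≡ scalar (det M)
  ⊗K-adjugate (mat a b c d) = mat-rows
    (cong₂ _,_ (cong (a * d +_) (*-negʳ b c)) (*-neg-cancel a b))
    (cong₂ _,_ (trans (cong (c * d +_) (*-negʳ d c)) (*-comm-cancel c d))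
               (trans (+-comm _ _) (cong₂ _+_ (*-comm d a) (trans (*-negʳ c b) (cong -_ (*-comm c b))))))

  adjugate-⊗K : ∀ M → adjugate M ⊗K M ≡ scalar (det M)
  adjugate-⊗K (mat a b c d) = mat-rows
    (cong₂ _,_ (cong₂ _+_ (*-comm d a) (*-negˡ b c))
               (trans (cong (d * b +_) (*-negˡ b d)) (*-comm-cancel d b)))
    (cong₂ _,_ (trans (+-comm _ _) (trans (cong (a * c +_) (*-negˡ c a)) (*-comm-cancel a c)))
               (trans (+-comm _ _) (cong (a * d +_) (trans (*-negˡ c b) (cong -_ (*-comm c b))))))

  ⊗K-•ʳ : ∀ k A B → A ⊗K (k • B) ≡ k • (A ⊗K B)
  ⊗K-•ʳ k (mat a b c d) (mat e f g h) =
    mat-rows (cong₂ _,_ (pull a e b g) (pull a f b h)) (cong₂ _,_ (pull c e d g) (pull c f d h))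
    where
    pull : ∀ x y z w → x * (k * y) + z * (k * w) ≡ k * (x * y + z * w)
    pull = solve 5 (λ k x y z w → x :* (k :* y) :+ z :* (k :* w) := k :* (x :* y :+ z :* w)) refl k

  •-⊗K : ∀ k A B → (k • A) ⊗K B ≡ k • (A ⊗K B)
  •-⊗K k (mat a b c d) (mat e f g h) =
    mat-rows (cong₂ _,_ (pull a e b g) (pull a f b h)) (cong₂ _,_ (pull c e d g) (pull c f d h))
    where
    pull : ∀ x y z w → (k * x) * y + (k * z) * w ≡ k * (x * y + z * w)
    pull = solve 5 (λ k x y z w → (k :* x) :* y :+ (k :* z) :* w := k :* (x :* y :+ z :* w)) refl k

  •-scalar-inverse : ∀ {k d} → k * d ≡ 1# → k • scalar d ≡ IK
  •-scalar-inverse {k} kd≡1 = mat-rows (cong₂ _,_ kd≡1 (zeroʳ k)) (cong₂ _,_ (zeroʳ k) kd≡1)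

  det≢0⇒isGL2K : ∀ M → det M ≢ 0# → IsGL2K M
  det≢0⇒isGL2K M det≢0 = e • adjugate M ,
    (begin
      M ⊗K (e • adjugate M)   ≡⟨ ⊗K-•ʳ e M (adjugate M) ⟩
      e • (M ⊗K adjugate M)   ≡⟨ cong (e •_) (⊗K-adjugate M) ⟩
      e • scalar (det M)      ≡⟨ •-scalar-inverse e*det≡1 ⟩
      IK                      ∎) ,
    (begin
      (e • adjugate M) ⊗K M   ≡⟨ •-⊗K e (adjugate M) M ⟩
      e • (adjugate M ⊗K M)   ≡⟨ cong (e •_) (adjugate-⊗K M) ⟩
      e • scalar (det M)      ≡⟨ •-scalar-inverse e*det≡1 ⟩
      IK                      ∎)
    where
    e : Carrier
    e = proj₁ (inverse (det M) det≢0)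
    e*det≡1 : e * det M ≡ 1#
    e*det≡1 = trans (*-comm e (det M)) (proj₂ (inverse (det M) det≢0))

  leftInverse⇒det≢0 : ∀ {A C} → A ⊗K C ≡ IK → det C ≢ 0#
  leftInverse⇒det≢0 {A} {C} A⊗C≡I detC≡0 = 0≢1 (begin
    0#               ≡⟨ sym (zeroʳ (det A)) ⟩
    det A * 0#       ≡⟨ cong (det A *_) (sym detC≡0) ⟩
    det A * det C    ≡⟨ sym (det-⊗K A C) ⟩
    det (A ⊗K C)     ≡⟨ cong det A⊗C≡I ⟩
    det IK           ≡⟨ det-IK ⟩
    1#               ∎)

  ·K-⊗K : ∀ v A B → (v ·K A) ·K B ≡ v ·K (A ⊗K B)
  ·K-⊗K (x , y) (mat a b c d) (mat e f g h) = cong₂ _,_ (assoc a b c d e g) (assoc a b c d f h)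
    where
    assoc : ∀ a b c d e g → (x * a + y * c) * e + (x * b + y * d) * g ≡ x * (a * e + b * g) + y * (c * e + d * g)
    assoc = solve 8 (λ x y a b c d e g →
      (x :* a :+ y :* c) :* e :+ (x :* b :+ y :* d) :* g := x :* (a :* e :+ b :* g) :+ y :* (c :* e :+ d :* g)) refl x y

  ·K-IK : ∀ v → v ·K IK ≡ v
  ·K-IK (x , y) = cong₂ _,_ (trans (cong₂ _+_ (*-identityʳ x) (zeroʳ y)) (+-identityʳ x))
                            (trans (cong₂ _+_ (zeroʳ x) (*-identityʳ y)) (+-identityˡ y))

  ·K-*ʳ : ∀ a b k M → (a * k , b * k) ·K M ≡ map (_* k) (_* k) ((a , b) ·K M)
  ·K-*ʳ a b k (mat p q r s) = cong₂ _,_ (pull p r) (pull q s)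
    where
    pull : ∀ p r → a * k * p + b * k * r ≡ (a * p + b * r) * k
    pull = solve 5 (λ a b k p r → a :* k :* p :+ b :* k :* r := (a :* p :+ b :* r) :* k) refl a b k

  ·K-solve : ∀ {A B v w} → A ⊗K B ≡ IK → v ·K A ≡ w → v ≡ w ·K B
  ·K-solve {A} {B} {v} {w} A⊗B≡I vA≡w = begin
    v                  ≡⟨ sym (·K-IK v) ⟩
    v ·K IK            ≡⟨ cong (v ·K_) (sym A⊗B≡I) ⟩
    v ·K (A ⊗K B)      ≡⟨ sym (·K-⊗K v A B) ⟩
    (v ·K A) ·K B      ≡⟨ cong (_·K B) vA≡w ⟩
    w ·K B             ∎

  -- The ring E

  lin-0 : ∀ f → fun f 0# ≡ 0#
  lin-0 f = x+x≈x⇒x≈0 (fun f 0#) (trans (sym (additive f 0# 0#)) (cong (fun f) (+-identityʳ 0#)))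

  isUnitE⇒1≢0 : ∀ γ → IsUnitE γ → fun γ 1# ≢ 0#
  isUnitE⇒1≢0 γ (δ , δγ≐id , _) γ1≡0 = 0≢1 (begin
    0#              ≡⟨ sym (lin-0 δ) ⟩
    fun δ 0#        ≡⟨ cong (fun δ) (sym γ1≡0) ⟩
    fun δ (fun γ 1#) ≡⟨ δγ≐id 1# ⟩
    1#              ∎)

  ρL : Carrier → Lin
  ρL m = lin (ρ m) (distribˡ m) (λ c x _ → swap m c x)
    where
    swap : ∀ m c x → m * (c * x) ≡ c * (m * x)
    swap = solve 3 (λ m c x → m :* (c :* x) := c :* (m :* x)) refl

  _∙L_ : Lin → Lin → Lin
  f ∙L g = lin (fun f ∙ fun g)
    (λ x y → trans (cong (fun g) (additive f x y)) (additive g (fun f x) (fun f y)))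
    (λ c x c∈Fq → trans (cong (fun g) (homog f c x c∈Fq)) (homog g c (fun f x) c∈Fq))

  proportional : ∀ {f g h : Fn} {r s y} → (∀ x → f x ≡ r * h x) → (∀ x → g x ≡ s * h x) →
                 g y ≢ 0# → Σ Carrier λ k → ∀ x → f x ≡ k * g x
  proportional {f} {g} {h} {r} {s} {y} f≐rh g≐sh gy≢0 = r * s⁻¹ , λ x → begin
    f x                  ≡⟨ f≐rh x ⟩
    r * h x              ≡⟨ cong (r *_) (sym (*-identityˡ (h x))) ⟩
    r * (1# * h x)       ≡⟨ cong (λ u → r * (u * h x)) (sym s*s⁻¹≡1) ⟩
    r * (s * s⁻¹ * h x)  ≡⟨ regroup r s s⁻¹ (h x) ⟩
    r * s⁻¹ * (s * h x)  ≡⟨ cong (r * s⁻¹ *_) (sym (g≐sh x)) ⟩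
    r * s⁻¹ * g x        ∎
    where
    s≢0 : s ≢ 0#
    s≢0 s≡0 = gy≢0 (trans (g≐sh y) (trans (cong (_* h y) s≡0) (zeroˡ (h y))))
    s⁻¹ : Carrier
    s⁻¹ = proj₁ (inverse s s≢0)
    s*s⁻¹≡1 : s * s⁻¹ ≡ 1#
    s*s⁻¹≡1 = proj₂ (inverse s s≢0)
    regroup : ∀ r s t z → r * (s * t * z) ≡ r * t * (s * z)
    regroup = solve 4 (λ r s t z → r :* (s :* t :* z) := r :* t :* (s :* z)) refl

  inverse-homomorphic : ∀ {η η⁻¹ : Fn} (_○_ : Carrier → Carrier → Carrier) →
    (∀ x → η⁻¹ (η x) ≡ x) → (∀ x → η (η⁻¹ x) ≡ x) →
    (∀ x y → η (x ○ y) ≡ η x ○ η y) → ∀ x y → η⁻¹ (x ○ y) ≡ η⁻¹ x ○ η⁻¹ y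
  inverse-homomorphic {η} {η⁻¹} _○_ left right hom x y = begin
    η⁻¹ (x ○ y)                        ≡⟨ cong η⁻¹ (sym (cong₂ _○_ (right x) (right y))) ⟩
    η⁻¹ (η (η⁻¹ x) ○ η (η⁻¹ y))        ≡⟨ cong η⁻¹ (sym (hom (η⁻¹ x) (η⁻¹ y))) ⟩
    η⁻¹ (η (η⁻¹ x ○ η⁻¹ y))            ≡⟨ left _ ⟩
    η⁻¹ x ○ η⁻¹ y                      ∎

  isGal-inverse : ∀ {η} (gal : IsGal η) → IsGal (IsGal.η⁻¹ gal)
  isGal-inverse {η} gal = record
    { hom+ = inverse-homomorphic _+_ left-inv right-inv hom+
    ; hom* = inverse-homomorphic _*_ left-inv right-inv hom*
    ; hom1 = trans (cong η⁻¹ (sym hom1)) (left-inv 1#)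
    ; η⁻¹ = η
    ; left-inv = right-inv
    ; right-inv = left-inv
    ; fixes-Fq = λ c c∈Fq → trans (cong η⁻¹ (sym (fixes-Fq c c∈Fq))) (left-inv c)
    }
    where open IsGal gal

  galoisLin : ∀ {η} → IsGal η → Lin
  galoisLin {η} gal = lin η hom+ (λ c x c∈Fq → trans (hom* c x) (cong (_* η x) (fixes-Fq c c∈Fq)))
    where open IsGal gal

  semilinear⇒isGal : (γ : Lin) → IsUnitE γ →
    (∀ a → Σ Carrier λ k → ∀ x → fun γ (a * x) ≡ k * fun γ x) →
    Σ Fn λ η → IsGal η × (∀ a x → fun γ (a * x) ≡ η a * fun γ x)
  semilinear⇒isGal γ γ-unit@(δ , δγ≐id , γδ≐id) semilinear = η , gal , γ-semilinear
    where
    g : Fn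
    g = fun γ
    s s⁻¹ : Carrier
    s = g 1#
    s⁻¹ = proj₁ (inverse s (isUnitE⇒1≢0 γ γ-unit))
    s*s⁻¹≡1 : s * s⁻¹ ≡ 1#
    s*s⁻¹≡1 = proj₂ (inverse s (isUnitE⇒1≢0 γ γ-unit))
    *s*s⁻¹ : ∀ y → y * s * s⁻¹ ≡ y
    *s*s⁻¹ y = trans (*-assoc y s s⁻¹) (trans (cong (y *_) s*s⁻¹≡1) (*-identityʳ y))
    *s⁻¹*s : ∀ y → y * s⁻¹ * s ≡ y
    *s⁻¹*s y = trans (*-assoc y s⁻¹ s) (trans (cong (y *_) (trans (*-comm s⁻¹ s) s*s⁻¹≡1)) (*-identityʳ y))
    η : Fn
    η a = g a * s⁻¹
    γ-semilinear : ∀ a x → g (a * x) ≡ η a * g x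
    γ-semilinear a x = begin
      g (a * x)               ≡⟨ proj₂ (semilinear a) x ⟩
      k * g x                 ≡⟨ cong (_* g x) (sym (*s*s⁻¹ k)) ⟩
      k * s * s⁻¹ * g x       ≡⟨ cong (λ u → u * s⁻¹ * g x) (sym (proj₂ (semilinear a) 1#)) ⟩
      g (a * 1#) * s⁻¹ * g x  ≡⟨ cong (λ u → g u * s⁻¹ * g x) (*-identityʳ a) ⟩
      η a * g x               ∎
      where
      k : Carrier
      k = proj₁ (semilinear a)
    gal : IsGal η
    gal = record
      { hom+ = λ x y → trans (cong (_* s⁻¹) (additive γ x y)) (distribʳ s⁻¹ (g x) (g y))
      ; hom* = λ x y → trans (cong (_* s⁻¹) (γ-semilinear x y)) (*-assoc (η x) (g y) s⁻¹)
      ; hom1 = s*s⁻¹≡1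
      ; η⁻¹ = λ y → fun δ (y * s)
      ; left-inv = λ x → trans (cong (fun δ) (*s⁻¹*s (g x))) (δγ≐id x)
      ; right-inv = λ y → trans (cong (_* s⁻¹) (γδ≐id (y * s))) (*s*s⁻¹ y)
      ; fixes-Fq = λ c c∈Fq → begin
          g c * s⁻¹        ≡⟨ cong (λ u → g u * s⁻¹) (sym (*-identityʳ c)) ⟩
          g (c * 1#) * s⁻¹ ≡⟨ cong (_* s⁻¹) (homog γ c 1# c∈Fq) ⟩
          c * s * s⁻¹      ≡⟨ *s*s⁻¹ c ⟩
          c                ∎
      }

  -- diag(g₁, g₂) · ρ(C) in E²ˣ²: entry (i, j) is x ↦ cᵢⱼ · gᵢ(x).
  rowsρ : Fn → Fn → Mat2 Carrier → Mat2 Fn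
  rowsρ g₁ g₂ C = mat (g₁ ∙ ρ (m11 C)) (g₁ ∙ ρ (m12 C)) (g₂ ∙ ρ (m21 C)) (g₂ ∙ ρ (m22 C))

  rowsρ-·K : ∀ {N : Mat2 Lin} {g₁ g₂ : Fn} {C : Mat2 Carrier} → funM N ≐M rowsρ g₁ g₂ C → ∀ u v →
    (fun (m11 N) u + fun (m21 N) v , fun (m12 N) u + fun (m22 N) v) ≡ (g₁ u , g₂ v) ·K C
  rowsρ-·K {g₁ = g₁} {g₂} {C} (e₁₁ , e₁₂ , e₂₁ , e₂₂) u v = cong₂ _,_
    (trans (cong₂ _+_ (e₁₁ u) (e₂₁ v)) (cong₂ _+_ (*-comm (m11 C) (g₁ u)) (*-comm (m21 C) (g₂ v))))
    (trans (cong₂ _+_ (e₁₂ u) (e₂₂ v)) (cong₂ _+_ (*-comm (m12 C) (g₁ u)) (*-comm (m22 C) (g₂ v))))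

  ι-·E-rowsρ : ∀ {N : Mat2 Lin} {M : Mat2 Carrier} {η : Fn} (γ : Lin) → IsUnitE γ →
    (∀ a x → fun γ (a * x) ≡ η a * fun γ x) → funM N ≐M rowsρ (fun γ) (fun γ) M →
    ∀ a b → (ι (a , b) ·E N) ∼ ι ((η a , η b) ·K M)
  ι-·E-rowsρ {N} {M} {η} γ γ-unit γ-semilinear N≐M a b =
    γ , γ-unit , (λ x → cong proj₁ (image x)) , (λ x → cong proj₂ (image x))
    where
    image : ∀ x → (fun (m11 N) (a * x) + fun (m21 N) (b * x) , fun (m12 N) (a * x) + fun (m22 N) (b * x))
                  ≡ map (_* fun γ x) (_* fun γ x) ((η a , η b) ·K M)
    image x = begin
      (fun (m11 N) (a * x) + fun (m21 N) (b * x) , fun (m12 N) (a * x) + fun (m22 N) (b * x))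
                                          ≡⟨ rowsρ-·K {N} N≐M (a * x) (b * x) ⟩
      (fun γ (a * x) , fun γ (b * x)) ·K M ≡⟨ cong (_·K M) (cong₂ _,_ (γ-semilinear a x) (γ-semilinear b x)) ⟩
      (η a * fun γ x , η b * fun γ x) ·K M ≡⟨ ·K-*ʳ (η a) (η b) (fun γ x) M ⟩
      map (_* fun γ x) (_* fun γ x) ((η a , η b) ·K M) ∎

  -- Collineations as projectivities

  galoisLin-isUnitE : ∀ {η} (gal : IsGal η) → IsUnitE (galoisLin gal)
  galoisLin-isUnitE gal = galoisLin (isGal-inverse gal) , IsGal.left-inv gal , IsGal.right-inv gal

  twist untwist : ∀ {η} → IsGal η → Mat2 Carrier → Mat2 Lin
  twist gal M = mat (galoisLin gal ∙L ρL (m11 M)) (galoisLin gal ∙L ρL (m12 M))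
                    (galoisLin gal ∙L ρL (m21 M)) (galoisLin gal ∙L ρL (m22 M))
  untwist gal M = mat (ρL (m11 M) ∙L η⁻¹L) (ρL (m12 M) ∙L η⁻¹L) (ρL (m21 M) ∙L η⁻¹L) (ρL (m22 M) ∙L η⁻¹L)
    where
    η⁻¹L : Lin
    η⁻¹L = galoisLin (isGal-inverse gal)

  twist-isGL2E : ∀ {η} (gal : IsGal η) M → IsGL2K M → IsGL2E (twist gal M)
  twist-isGL2E {η} gal M (M′ , M⊗M′≡I , M′⊗M≡I) = untwist gal M′ ,
    ( (λ x → trans (twist-untwist (cong m11 M⊗M′≡I) x) (η⁻¹-1* x))
    , (λ x → trans (twist-untwist (cong m12 M⊗M′≡I) x) (η⁻¹-0* x))
    , (λ x → trans (twist-untwist (cong m21 M⊗M′≡I) x) (η⁻¹-0* x))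
    , (λ x → trans (twist-untwist (cong m22 M⊗M′≡I) x) (η⁻¹-1* x)) ) ,
    ( (λ x → trans (untwist-twist (cong m11 M′⊗M≡I) x) (*-identityˡ x))
    , (λ x → trans (untwist-twist (cong m12 M′⊗M≡I) x) (zeroˡ x))
    , (λ x → trans (untwist-twist (cong m21 M′⊗M≡I) x) (zeroˡ x))
    , (λ x → trans (untwist-twist (cong m22 M′⊗M≡I) x) (*-identityˡ x)) )
    where
    open IsGal gal
    η⁻¹-1* : ∀ x → η⁻¹ (1# * η x) ≡ x
    η⁻¹-1* x = trans (cong η⁻¹ (*-identityˡ (η x))) (left-inv x)
    η⁻¹-0* : ∀ x → η⁻¹ (0# * η x) ≡ 0#
    η⁻¹-0* x = trans (cong η⁻¹ (zeroˡ (η x))) (lin-0 (galoisLin (isGal-inverse gal)))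
    regroup : ∀ p q r s z → q * (p * z) + s * (r * z) ≡ (p * q + r * s) * z
    regroup = solve 5 (λ p q r s z → q :* (p :* z) :+ s :* (r :* z) := (p :* q :+ r :* s) :* z) refl
    twist-untwist : ∀ {p q r s w} → p * q + r * s ≡ w → ∀ x →
                    η⁻¹ (q * (p * η x)) + η⁻¹ (s * (r * η x)) ≡ η⁻¹ (w * η x)
    twist-untwist {p} {q} {r} {s} pq+rs≡w x =
      trans (sym (IsGal.hom+ (isGal-inverse gal) _ _))
            (cong η⁻¹ (trans (regroup p q r s (η x)) (cong (_* η x) pq+rs≡w)))
    untwist-twist : ∀ {p q r s w} → p * q + r * s ≡ w → ∀ x →
                    q * η (η⁻¹ (p * x)) + s * η (η⁻¹ (r * x)) ≡ w * x
    untwist-twist {p} {q} {r} {s} pq+rs≡w x =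
      trans (cong₂ (λ u v → q * u + s * v) (right-inv (p * x)) (right-inv (r * x)))
            (trans (regroup p q r s x) (cong (_* x) pq+rs≡w))

  ≐M-refl : ∀ {M : Mat2 Fn} → M ≐M M
  ≐M-refl = (λ _ → refl) , (λ _ → refl) , (λ _ → refl) , (λ _ → refl)

  forward : ∀ M → IsGL2K M → ∀ η → IsGal η →
    Σ (Mat2 Lin) λ N → IsGL2E N × (∀ a b → NonZeroPair a b → (ι (a , b) ·E N) ∼ ι ((η a , η b) ·K M))
  forward M M-gl η gal = twist gal M , twist-isGL2E gal M M-gl ,
    λ a b _ → ι-·E-rowsρ {twist gal M} (galoisLin gal) (galoisLin-isUnitE gal) (IsGal.hom* gal) ≐M-refl a b

  -- Projectivities preserving PG(1, F)

  ρ1⊞ρ0 : ∀ (f : Fn) (g : Lin) → ((ρ 1# ∙ f) ⊞ (ρ 0# ∙ fun g)) ≐ f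
  ρ1⊞ρ0 f g x = trans (cong₂ _+_ (cong f (*-identityˡ x)) (trans (cong (fun g) (zeroˡ x)) (lin-0 g)))
                      (+-identityʳ (f x))

  ρ0⊞ρ1 : ∀ (f : Lin) (g : Fn) → ((ρ 0# ∙ fun f) ⊞ (ρ 1# ∙ g)) ≐ g
  ρ0⊞ρ1 f g x = trans (cong₂ _+_ (trans (cong (fun f) (zeroˡ x)) (lin-0 f)) (cong g (*-identityˡ x)))
                      (+-identityˡ (g x))

  ImagesInPGF : Mat2 Lin → Set
  ImagesInPGF N = ∀ a b → NonZeroPair a b →
    Σ Carrier λ c → Σ Carrier λ d → NonZeroPair c d × (ι (a , b) ·E N) ∼ ι (c , d)

  basis-rows : ∀ N → ImagesInPGF N →
    Σ (Mat2 Carrier) λ C → Σ Lin λ γ₁ → Σ Lin λ γ₂ →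
      IsUnitE γ₁ × IsUnitE γ₂ × funM N ≐M rowsρ (fun γ₁) (fun γ₂) C
  basis-rows N image with image 1# 0# (λ (1≡0 , _) → 0≢1 (sym 1≡0)) | image 0# 1# (λ (_ , 1≡0) → 0≢1 (sym 1≡0))
  ... | c₁ , d₁ , _ , γ₁ , γ₁-unit , e₁₁ , e₁₂ | c₂ , d₂ , _ , γ₂ , γ₂-unit , e₂₁ , e₂₂ =
    mat c₁ d₁ c₂ d₂ , γ₁ , γ₂ , γ₁-unit , γ₂-unit ,
    (λ x → trans (sym (ρ1⊞ρ0 (fun (m11 N)) (m21 N) x)) (e₁₁ x)) ,
    (λ x → trans (sym (ρ1⊞ρ0 (fun (m12 N)) (m22 N) x)) (e₁₂ x)) ,
    (λ x → trans (sym (ρ0⊞ρ1 (m11 N) (fun (m21 N)) x)) (e₂₁ x)) ,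
    (λ x → trans (sym (ρ0⊞ρ1 (m12 N) (fun (m22 N)) x)) (e₂₂ x))

  converse : ∀ N → IsGL2E N → PreservesPGF N →
    Σ (Mat2 Carrier) λ M → IsGL2K M × Σ Fn λ η → IsGal η ×
      (∀ a b → NonZeroPair a b → (ι (a , b) ·E N) ∼ ι ((η a , η b) ·K M))
  converse N (N′ , _ , i₁₁ , i₁₂ , i₂₁ , i₂₂) (image , _) with basis-rows N image
  ... | C , γ₁ , γ₂ , γ₁-unit , γ₂-unit , N≐C@(e₁₁ , e₁₂ , e₂₁ , e₂₂) =
    M , det≢0⇒isGL2K M detM≢0 , η , gal , λ a b _ → ι-·E-rowsρ {N} γ₁ γ₁-unit γ₁-semilinear N≐M a b
    where
    g₁ g₂ : Fn
    g₁ = fun γ₁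
    g₂ = fun γ₂

    row : ∀ {u v p q} → fun (m11 N) u + fun (m21 N) v ≡ p → fun (m12 N) u + fun (m22 N) v ≡ q →
          (g₁ u , g₂ v) ·K C ≡ (p , q)
    row e e′ = trans (sym (rowsρ-·K {N} N≐C _ _)) (cong₂ _,_ e e′)

    A : Mat2 Carrier
    A = mat (g₁ (fun (m11 N′) 1#)) (g₂ (fun (m12 N′) 1#)) (g₁ (fun (m21 N′) 1#)) (g₂ (fun (m22 N′) 1#))

    A⊗C≡I : A ⊗K C ≡ IK
    A⊗C≡I = mat-rows (row (i₁₁ 1#) (i₁₂ 1#)) (row (i₂₁ 1#) (i₂₂ 1#))

    detC≢0 : det C ≢ 0#
    detC≢0 = leftInverse⇒det≢0 A⊗C≡I

    C⁻¹ : Mat2 Carrier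
    C⁻¹ = proj₁ (det≢0⇒isGL2K C detC≢0)

    over-g₂ : ∀ a → Σ Carrier λ k → ∀ x → g₁ (a * x) ≡ k * g₂ x
    over-g₂ a with image a 1# (λ (_ , 1≡0) → 0≢1 (sym 1≡0))
    ... | c , d , _ , γ , _ , e , e′ =
      proportional {f = λ x → g₁ (a * x)} {g = g₂} {h = fun γ}
        (λ x → cong proj₁ (solved x))
        (λ x → trans (cong g₂ (sym (*-identityˡ x))) (cong proj₂ (solved x)))
        (isUnitE⇒1≢0 γ₂ γ₂-unit)
      where
      solved : ∀ x → (g₁ (a * x) , g₂ (1# * x)) ≡ map (_* fun γ x) (_* fun γ x) ((c , d) ·K C⁻¹)
      solved x = trans (·K-solve (proj₁ (proj₂ (det≢0⇒isGL2K C detC≢0))) (row (e x) (e′ x)))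
                       (·K-*ʳ c d (fun γ x) C⁻¹)

    g₁-over-g₂ : ∀ x → g₁ x ≡ proj₁ (over-g₂ 1#) * g₂ x
    g₁-over-g₂ x = trans (cong g₁ (sym (*-identityˡ x))) (proj₂ (over-g₂ 1#) x)

    g₁1≢0 : g₁ 1# ≢ 0#
    g₁1≢0 = isUnitE⇒1≢0 γ₁ γ₁-unit

    g₂-over-g₁ : Σ Carrier λ μ → ∀ x → g₂ x ≡ μ * g₁ x
    g₂-over-g₁ = proportional {f = g₂} {g = g₁} (λ x → sym (*-identityˡ (g₂ x))) g₁-over-g₂ g₁1≢0

    μ : Carrier
    μ = proj₁ g₂-over-g₁

    semilinear : Σ Fn λ η → IsGal η × (∀ a x → g₁ (a * x) ≡ η a * g₁ x)
    semilinear = semilinear⇒isGal γ₁ γ₁-unit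
      (λ a → proportional {f = λ x → g₁ (a * x)} {g = g₁} (proj₂ (over-g₂ a)) g₁-over-g₂ g₁1≢0)

    η : Fn
    η = proj₁ semilinear
    gal : IsGal η
    gal = proj₁ (proj₂ semilinear)
    γ₁-semilinear : ∀ a x → g₁ (a * x) ≡ η a * g₁ x
    γ₁-semilinear = proj₂ (proj₂ semilinear)

    M : Mat2 Carrier
    M = mat (m11 C) (m12 C) (μ * m21 C) (μ * m22 C)

    detM≢0 : det M ≢ 0#
    detM≢0 = subst (_≢ 0#) (sym (det-scaleRow₂ (m11 C) (m12 C) (m21 C) (m22 C) μ))
      (*-nonzero (nonzero-factorˡ (subst (_≢ 0#) (proj₂ g₂-over-g₁ 1#) (isUnitE⇒1≢0 γ₂ γ₂-unit))) detC≢0)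

    rescale : ∀ c y → c * g₂ y ≡ (μ * c) * g₁ y
    rescale c y = trans (cong (c *_) (proj₂ g₂-over-g₁ y)) (swap c μ (g₁ y))
      where
      swap : ∀ c μ z → c * (μ * z) ≡ (μ * c) * z
      swap = solve 3 (λ c μ z → c :* (μ :* z) := (μ :* c) :* z) refl

    N≐M : funM N ≐M rowsρ g₁ g₁ M
    N≐M = e₁₁ , e₁₂ , (λ y → trans (e₂₁ y) (rescale (m21 C) y)) , (λ y → trans (e₂₂ y) (rescale (m22 C) y))

proposition11 : (q t : ℕ) → IsPrimePower q → 2 ≤ t →
    (K : Field) → (Fq : Field.Carrier K → Bool) →
    let open Setup K Fq in
    IsSubfield → HasSize (q ^ t) → SubfieldHasSize q →
    ((M : Mat2 Carrier) → IsGL2K M → (η : Carrier → Carrier) → IsGal η →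
       Σ (Mat2 Lin) λ N → IsGL2E N ×
         (∀ a b → NonZeroPair a b →
            (ι (a , b) ·E N) ∼ ι ((η a , η b) ·K M)))
    ×
    ((N : Mat2 Lin) → IsGL2E N → PreservesPGF N →
       Σ (Mat2 Carrier) λ M → IsGL2K M × Σ (Carrier → Carrier) λ η → IsGal η ×
         (∀ a b → NonZeroPair a b →
            (ι (a , b) ·E N) ∼ ι ((η a , η b) ·K M)))
-- The argument works over any field and any subset Fq; size and subfield hypotheses are unused.
proposition11 _ _ _ _ K Fq _ _ _ = forward K Fq , converse K Fq
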